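{- Let $q$ be a prime power and $r,t\ge 2$ integers. Any $t+1$ distinct points of the variety $\mathcal V_{r,t}\subseteq \mathrm{PG}(r^t-1,q^t)$ are in general position, i.e. they span a projective subspace of dimension $t$.
   Context: Let $\mathfrak F$ be the set of all functions $f:\{0,\ldots,t-1\}\to\{0,\ldots,r-1\}$, indexing the coordinates of $\mathrm{PG}(r^t-1,q^t)$. For a point $P=\langle (x_0,\ldots,x_{r-1})\rangle$ of $\mathrm{PG}(r-1,q^t)$, $P^{\alpha}$ is the point of $\mathrm{PG}(r^t-1,q^t)$ whose coordinate indexed by $f$ is $\prod_{i=0}^{t-1}x_{f(i)}^{q^i}$. The variety $\mathcal V_{r,t}$ is $\{P^{\alpha}:P\in\mathrm{PG}(r-1,q^t)\}$ (the twisted tensor embedding of $\mathrm{PG}(r-1,q^t)$; equivalently, the Grassmann image of a Desarguesian $(t-1)$-spread of $\mathrm{PG}(rt-1,q)$). -}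

module Defs where

open import Level using (Level; _⊔_) renaming (suc to lsuc)
open import Data.Nat using (ℕ; zero; suc; _^_)
open import Data.Nat.Primality using (Prime)
open import Data.Fin using (Fin; toℕ) renaming (zero to fzero; suc to fsuc)
open import Data.Product using (Σ; ∃; ∃₂; _×_)
open import Relation.Nullary using (¬_)
open import Relation.Binary.PropositionalEquality using (_≡_)
open import Algebra.Bundles using (CommutativeRing)

IsPrimePower : ℕ → Set
IsPrimePower q = ∃₂ λ p k → Prime p × (q ≡ p ^ suc k)

record Field (c ℓ : Level) : Set (lsuc (c ⊔ ℓ)) where
  field
    commutativeRing : CommutativeRing c ℓ
  open CommutativeRing commutativeRing public
  field
    0#≉1# : ¬ (0# ≈ 1#)
    inverse : ∀ x → ¬ (x ≈ 0#) → ∃ λ y → (x * y) ≈ 1#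

module _ {c ℓ : Level} (F : Field c ℓ) where
  open Field F

  HasCardinality : ℕ → Set (c ⊔ ℓ)
  HasCardinality n = Σ (Fin n → Carrier) λ e →
    (∀ i j → e i ≈ e j → i ≡ j) × (∀ x → ∃ λ i → e i ≈ x)

  pow : Carrier → ℕ → Carrier
  pow x zero = 1#
  pow x (suc n) = x * pow x n

  sumF : (m : ℕ) → (Fin m → Carrier) → Carrier
  sumF zero g = 0#
  sumF (suc m) g = g fzero + sumF m (λ i → g (fsuc i))

  prodF : (m : ℕ) → (Fin m → Carrier) → Carrier
  prodF zero g = 1#
  prodF (suc m) g = g fzero * prodF m (λ i → g (fsuc i))

  -- a nonzero vector of F^r (represents a point of PG(r-1, F))
  NonZeroVec : {r : ℕ} → (Fin r → Carrier) → Set ℓ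
  NonZeroVec {r} x = ¬ (∀ k → x k ≈ 0#)

  ProjEq : {r : ℕ} → (Fin r → Carrier) → (Fin r → Carrier) → Set (c ⊔ ℓ)
  ProjEq {r} x y = ∃ λ a → ∀ k → x k ≈ (a * y k)

  -- the twisted tensor embedding: coordinate indexed by f : {0..t-1} → {0..r-1}
  -- is  Π_{i=0}^{t-1} x_{f(i)}^{q^i}
  alpha : (q t r : ℕ) → (Fin r → Carrier) → (Fin t → Fin r) → Carrier
  alpha q t r x f = prodF t (λ i → pow (x (f i)) (q ^ toℕ i))

  LinIndep : {a : Level} {I : Set a} (m : ℕ) → (Fin m → I → Carrier) → Set (a ⊔ c ⊔ ℓ)
  LinIndep {I = I} m v = (coef : Fin m → Carrier) →
    (∀ (f : I) → sumF m (λ i → coef i * v i f) ≈ 0#) → ∀ i → coef i ≈ 0#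

-- Fix j₀ and let j_0, …, j_{t-1} be the other indices. Since P_{j_i} and P_{j₀} are distinct
-- projective points, some 2 × 2 minor (k_i, l_i) of (P_{j₀}, P_{j_i}) is nonzero. The linear form
-- w ↦ (P_{j_i})_{l_i}^{q^i} w_{k_i} − (P_{j_i})_{k_i}^{q^i} w_{l_i} vanishes on the q^i-th power of
-- P_{j_i} but not on that of P_{j₀}, because x ↦ x^{q^i} is injective on a field with q^t elements.
-- Paired with P^α, the tensor product of these t forms gives the product of the forms evaluated at
-- the powers P^{(q^i)}; so it vanishes at P_j^α for every j ≠ j₀ but not at P_{j₀}^α, and P_{j₀}^α
-- has coefficient 0 in every vanishing linear combination.
module Submission where

open import Level using (Level)
open import Defs
open import Function using (_∘_)
open import Data.Nat as ℕ using (ℕ; zero; suc; _≤_)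
import Data.Nat.Properties as ℕ
open import Data.Fin using (Fin; toℕ; punchIn; punchOut) renaming (zero to fzero; suc to fsuc)
import Data.Fin.Properties as Fin
open import Data.Fin.Permutation using (Permutation; permutation)
open import Data.Vec.Functional using (Vector; _∷_; replicate)
open import Data.Product using (∃₂; _,_; proj₁; proj₂)
open import Relation.Nullary using (¬_; yes; no)
open import Relation.Nullary.Negation using (contradiction)
open import Relation.Binary.Definitions using (Decidable)
open import Relation.Binary.PropositionalEquality as ≡ using (_≡_; _≢_)
open import Algebra.Bundles using (CommutativeSemiring)

module FiniteSums {c ℓ : Level} (R : CommutativeSemiring c ℓ) where
  open CommutativeSemiring R
  open import Relation.Binary.Reasoning.Setoid setoid
  open import Algebra.Properties.CommutativeSemigroup *-commutativeSemigroup using (x∙yz≈y∙xz)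
  open import Algebra.Properties.Semiring.Exp semiring public using (_^_)
  open import Algebra.Properties.Semiring.Sum semiring public
    using ( sum-cong-≋; sum-cong-≗; sum-remove; sum-replicate-zero; ∑-comm; ∑-distrib-+
          ; *-distribˡ-sum; *-distribʳ-sum)
    renaming (sum to ∑)
  open import Algebra.Properties.CommutativeMonoid.Sum *-commutativeMonoid public
    using ()
    renaming (sum to ∏; sum-cong-≋ to ∏-cong; sum-cong-≗ to ∏-cong-≗; sum-remove to ∏-remove;
              sum-permute to ∏-permute; ∑-distrib-+ to ∏-distrib-*; sum-replicate to ∏-replicate)

  ∑-single : ∀ {n} (g : Vector Carrier n) j → (∀ i → i ≢ j → g i ≈ 0#) → ∑ g ≈ g j
  ∑-single {suc n} g j others = begin
    ∑ g                                ≈⟨ sum-remove {i = j} g ⟩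
    g j + ∑ (λ i → g (punchIn j i))    ≈⟨ +-congˡ (sum-cong-≋ (λ i → others _ (Fin.punchInᵢ≢i j i))) ⟩
    g j + ∑ (replicate n 0#)           ≈⟨ +-congˡ (sum-replicate-zero n) ⟩
    g j + 0#                           ≈⟨ +-identityʳ (g j) ⟩
    g j                                ∎

  ∏-zero : ∀ {n} (g : Vector Carrier n) j → g j ≈ 0# → ∏ g ≈ 0#
  ∏-zero {suc n} g j gj≈0 = trans (∏-remove {i = j} g) (trans (*-congʳ gj≈0) (zeroˡ _))

  ∏-scale : ∀ {n} x (g : Vector Carrier n) → ∏ (λ k → x * g k) ≈ x ^ n * ∏ g
  ∏-scale {n} x g = trans (∏-distrib-* (replicate n x) g) (*-congʳ (∏-replicate n))

  ∏-scale-except : ∀ {n} x (a b : Vector Carrier n) j →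
    (∀ k → k ≢ j → a k ≈ x * b k) → a j ≈ b j → x * ∏ a ≈ x ^ n * ∏ b
  ∏-scale-except {suc n} x a b j scaled fixed = begin
    x * ∏ a                                      ≈⟨ *-congˡ (∏-remove {i = j} a) ⟩
    x * (a j * ∏ (a ∘ punchIn j))                ≈⟨ *-congˡ (*-cong fixed others) ⟩
    x * (b j * (x ^ n * ∏ (b ∘ punchIn j)))      ≈⟨ *-congˡ (x∙yz≈y∙xz _ _ _) ⟩
    x * (x ^ n * (b j * ∏ (b ∘ punchIn j)))      ≈⟨ sym (*-assoc _ _ _) ⟩
    x ^ suc n * (b j * ∏ (b ∘ punchIn j))        ≈⟨ *-congˡ (sym (∏-remove {i = j} b)) ⟩
    x ^ suc n * ∏ b                              ∎
    where
    others : ∏ (a ∘ punchIn j) ≈ x ^ n * ∏ (b ∘ punchIn j)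
    others = trans (∏-cong (λ i → scaled _ (Fin.punchInᵢ≢i j i))) (∏-scale x (b ∘ punchIn j))

  δ : ∀ {n} → Fin n → Fin n → Carrier
  δ k k′ with k Fin.≟ k′
  ... | yes _ = 1#
  ... | no  _ = 0#

  ∑-δ : ∀ {n} k (y : Vector Carrier n) → ∑ (λ k′ → δ k k′ * y k′) ≈ y k
  ∑-δ k y = trans (∑-single (λ k′ → δ k k′ * y k′) k off-diagonal) diagonal
    where
    off-diagonal : ∀ k′ → k′ ≢ k → δ k k′ * y k′ ≈ 0#
    off-diagonal k′ k′≢k with k Fin.≟ k′
    ... | yes k≡k′ = contradiction (≡.sym k≡k′) k′≢k
    ... | no  _    = zeroˡ (y k′)

    diagonal : δ k k * y k ≈ y k
    diagonal with k Fin.≟ k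
    ... | yes _   = *-identityˡ (y k)
    ... | no  k≢k = contradiction ≡.refl k≢k

  ∑-δ-pair : ∀ {n} a b k l (y : Vector Carrier n) →
    ∑ (λ k′ → (a * δ k k′ + b * δ l k′) * y k′) ≈ a * y k + b * y l
  ∑-δ-pair a b k l y = begin
    ∑ (λ k′ → (a * δ k k′ + b * δ l k′) * y k′)
      ≈⟨ sum-cong-≋ (λ k′ → trans (distribʳ (y k′) _ _) (+-cong (*-assoc a _ _) (*-assoc b _ _))) ⟩
    ∑ (λ k′ → a * (δ k k′ * y k′) + b * (δ l k′ * y k′))
      ≈⟨ ∑-distrib-+ (λ k′ → a * (δ k k′ * y k′)) (λ k′ → b * (δ l k′ * y k′)) ⟩
    ∑ (λ k′ → a * (δ k k′ * y k′)) + ∑ (λ k′ → b * (δ l k′ * y k′))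
      ≈⟨ sym (+-cong (*-distribˡ-sum a (λ k′ → δ k k′ * y k′)) (*-distribˡ-sum b (λ k′ → δ l k′ * y k′))) ⟩
    a * ∑ (λ k′ → δ k k′ * y k′) + b * ∑ (λ k′ → δ l k′ * y k′)
      ≈⟨ +-cong (*-congˡ (∑-δ k y)) (*-congˡ (∑-δ l y)) ⟩
    a * y k + b * y l
      ∎

  ∑ᶠ : ∀ {r} m → ((Fin m → Fin r) → Carrier) → Carrier
  ∑ᶠ zero    G = G (λ ())
  ∑ᶠ (suc m) G = ∑ (λ k → ∑ᶠ m (λ f → G (k ∷ f)))

  ∑ᶠ-cong : ∀ {r} m {G H : (Fin m → Fin r) → Carrier} → (∀ f → G f ≈ H f) → ∑ᶠ m G ≈ ∑ᶠ m H
  ∑ᶠ-cong zero    G≈H = G≈H _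
  ∑ᶠ-cong (suc m) G≈H = sum-cong-≋ (λ k → ∑ᶠ-cong m (λ f → G≈H (k ∷ f)))

  *-distribˡ-∑ᶠ : ∀ {r} m x (G : (Fin m → Fin r) → Carrier) → x * ∑ᶠ m G ≈ ∑ᶠ m (λ f → x * G f)
  *-distribˡ-∑ᶠ zero    x G = refl
  *-distribˡ-∑ᶠ (suc m) x G =
    trans (*-distribˡ-sum x (λ k → ∑ᶠ m (λ f → G (k ∷ f))))
          (sum-cong-≋ (λ k → *-distribˡ-∑ᶠ m x (λ f → G (k ∷ f))))

  ∑ᶠ-zero : ∀ {r} m {G : (Fin m → Fin r) → Carrier} → (∀ f → G f ≈ 0#) → ∑ᶠ m G ≈ 0#
  ∑ᶠ-zero m {G} G≈0 = begin
    ∑ᶠ m G                   ≈⟨ ∑ᶠ-cong m (λ f → trans (G≈0 f) (sym (zeroˡ (G f)))) ⟩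
    ∑ᶠ m (λ f → 0# * G f)    ≈⟨ sym (*-distribˡ-∑ᶠ m 0# G) ⟩
    0# * ∑ᶠ m G              ≈⟨ zeroˡ _ ⟩
    0#                       ∎

  ∑ᶠ-comm-∑ : ∀ {r n} m (H : (Fin m → Fin r) → Fin n → Carrier) →
    ∑ᶠ m (λ f → ∑ (H f)) ≈ ∑ (λ j → ∑ᶠ m (λ f → H f j))
  ∑ᶠ-comm-∑ zero    H = refl
  ∑ᶠ-comm-∑ (suc m) H =
    trans (sum-cong-≋ (λ k → ∑ᶠ-comm-∑ m (λ f → H (k ∷ f))))
          (∑-comm (λ k j → ∑ᶠ m (λ f → H (k ∷ f) j)))

  ∑ᶠ-∏ : ∀ {r} m (g : Fin m → Fin r → Carrier) →
    ∑ᶠ m (λ f → ∏ (λ i → g i (f i))) ≈ ∏ (λ i → ∑ (g i))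
  ∑ᶠ-∏ zero    g = refl
  ∑ᶠ-∏ (suc m) g = begin
    ∑ (λ k → ∑ᶠ m (λ f → g fzero k * ∏ (λ i → g (fsuc i) (f i))))
      ≈⟨ sum-cong-≋ (λ k → sym (*-distribˡ-∑ᶠ m (g fzero k) _)) ⟩
    ∑ (λ k → g fzero k * ∑ᶠ m (λ f → ∏ (λ i → g (fsuc i) (f i))))
      ≈⟨ sum-cong-≋ (λ k → *-congˡ {g fzero k} (∑ᶠ-∏ m (g ∘ fsuc))) ⟩
    ∑ (λ k → g fzero k * ∏ (λ i → ∑ (g (fsuc i))))
      ≈⟨ sym (*-distribʳ-sum (∏ (λ i → ∑ (g (fsuc i)))) (g fzero)) ⟩
    ∑ (g fzero) * ∏ (λ i → ∑ (g (fsuc i)))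
      ∎

module FieldProperties {c ℓ : Level} (F : Field c ℓ) where
  open Field F
  open FiniteSums commutativeSemiring
  open import Relation.Binary.Reasoning.Setoid setoid
  open import Algebra.Properties.CommutativeSemigroup *-commutativeSemigroup using (x∙yz≈y∙xz)
  open import Algebra.Properties.Semiring.Exp semiring using (^-congˡ; ^-assocʳ)

  pow≡^ : ∀ x n → pow F x n ≡ x ^ n
  pow≡^ x zero    = ≡.refl
  pow≡^ x (suc n) = ≡.cong (x *_) (pow≡^ x n)

  sumF≡∑ : ∀ m (g : Vector Carrier m) → sumF F m g ≡ ∑ g
  sumF≡∑ zero    g = ≡.refl
  sumF≡∑ (suc m) g = ≡.cong (g fzero +_) (sumF≡∑ m (g ∘ fsuc))

  prodF≡∏ : ∀ m (g : Vector Carrier m) → prodF F m g ≡ ∏ g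
  prodF≡∏ zero    g = ≡.refl
  prodF≡∏ (suc m) g = ≡.cong (g fzero *_) (prodF≡∏ m (g ∘ fsuc))

  *-cancelˡ : ∀ {x y z} → x ≉ 0# → x * y ≈ x * z → y ≈ z
  *-cancelˡ {x} {y} {z} x≉0 xy≈xz with inverse x x≉0
  ... | x⁻¹ , xx⁻¹≈1 = begin
    y              ≈⟨ sym (*-identityˡ y) ⟩
    1# * y         ≈⟨ *-congʳ (sym x⁻¹x≈1) ⟩
    (x⁻¹ * x) * y  ≈⟨ *-assoc x⁻¹ x y ⟩
    x⁻¹ * (x * y)  ≈⟨ *-congˡ xy≈xz ⟩
    x⁻¹ * (x * z)  ≈⟨ sym (*-assoc x⁻¹ x z) ⟩
    (x⁻¹ * x) * z  ≈⟨ *-congʳ x⁻¹x≈1 ⟩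
    1# * z         ≈⟨ *-identityˡ z ⟩
    z              ∎
    where
    x⁻¹x≈1 : x⁻¹ * x ≈ 1#
    x⁻¹x≈1 = trans (*-comm x⁻¹ x) xx⁻¹≈1

  x≉0∧xy≈0⇒y≈0 : ∀ {x y} → x ≉ 0# → x * y ≈ 0# → y ≈ 0#
  x≉0∧xy≈0⇒y≈0 {x} x≉0 xy≈0 = *-cancelˡ x≉0 (trans xy≈0 (sym (zeroʳ x)))

  x≉0∧y≉0⇒xy≉0 : ∀ {x y} → x ≉ 0# → y ≉ 0# → x * y ≉ 0#
  x≉0∧y≉0⇒xy≉0 x≉0 y≉0 = y≉0 ∘ x≉0∧xy≈0⇒y≈0 x≉0

  ∏-≉0 : ∀ {n} (g : Vector Carrier n) → (∀ i → g i ≉ 0#) → ∏ g ≉ 0#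
  ∏-≉0 {zero}  g _   = 0#≉1# ∘ sym
  ∏-≉0 {suc n} g g≉0 = x≉0∧y≉0⇒xy≉0 (g≉0 fzero) (∏-≉0 (g ∘ fsuc) (g≉0 ∘ fsuc))

  0^n≈0 : ∀ n .{{_ : ℕ.NonZero n}} → 0# ^ n ≈ 0#
  0^n≈0 (suc n) = zeroˡ (0# ^ n)

  ^-injective : ∀ a b → (∀ x → x ^ (a ℕ.* b) ≈ x) → ∀ {x y} → x ^ a ≈ y ^ a → x ≈ y
  ^-injective a b idempotent {x} {y} xᵃ≈yᵃ = begin
    x              ≈⟨ sym (idempotent x) ⟩
    x ^ (a ℕ.* b)  ≈⟨ sym (^-assocʳ x a b) ⟩
    (x ^ a) ^ b    ≈⟨ ^-congˡ b xᵃ≈yᵃ ⟩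
    (y ^ a) ^ b    ≈⟨ ^-assocʳ y a b ⟩
    y ^ (a ℕ.* b)  ≈⟨ idempotent y ⟩
    y              ∎

  minors-vanish⇒ProjEq : ∀ {r} (u v : Fin r → Carrier) l → v l ≉ 0# →
    (∀ k → u k * v l ≈ u l * v k) → ProjEq F u v
  minors-vanish⇒ProjEq u v l vl≉0 minors with inverse (v l) vl≉0
  ... | w , vlw≈1 = u l * w , proportional
    where
    proportional : ∀ k → u k ≈ (u l * w) * v k
    proportional k = begin
      u k                ≈⟨ sym (*-identityʳ (u k)) ⟩
      u k * 1#           ≈⟨ *-congˡ (sym vlw≈1) ⟩
      u k * (v l * w)    ≈⟨ sym (*-assoc (u k) (v l) w) ⟩
      (u k * v l) * w    ≈⟨ *-congʳ (minors k) ⟩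
      (u l * v k) * w    ≈⟨ *-assoc (u l) (v k) w ⟩
      u l * (v k * w)    ≈⟨ *-congˡ (*-comm (v k) w) ⟩
      u l * (w * v k)    ≈⟨ sym (*-assoc (u l) w (v k)) ⟩
      (u l * w) * v k    ∎

  distinct⇒nonzero-minor : Decidable _≈_ → ∀ {r} (u v : Fin r → Carrier) →
    NonZeroVec F v → ¬ ProjEq F u v → ∃₂ λ k l → u k * v l ≉ u l * v k
  distinct⇒nonzero-minor _≟_ {r} u v v≢0 u≁v
    with Fin.¬∀⟶∃¬ r (λ l → v l ≈ 0#) (λ l → v l ≟ 0#) v≢0
  ... | l , vl≉0 with Fin.¬∀⟶∃¬ r _ (λ k → (u k * v l) ≟ (u l * v k)) (u≁v ∘ minors-vanish⇒ProjEq u v l vl≉0)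
  ...   | k , minor≉0 = k , l , minor≉0

  separated⇒coef≈0 : ∀ {m s r} (v : Fin m → (Fin s → Fin r) → Carrier) (W : (Fin s → Fin r) → Carrier)
    (coef : Fin m → Carrier) j →
    (∀ f → ∑ (λ i → coef i * v i f) ≈ 0#) →
    (∀ i → i ≢ j → ∑ᶠ s (λ f → W f * v i f) ≈ 0#) →
    ∑ᶠ s (λ f → W f * v j f) ≉ 0# →
    coef j ≈ 0#
  separated⇒coef≈0 {s = s} v W coef j relation others target≉0 =
    x≉0∧xy≈0⇒y≈0 target≉0 (trans (*-comm (φ j) (coef j)) (begin
      coef j * φ j
        ≈⟨ sym (∑-single (λ i → coef i * φ i) j (λ i i≢j → trans (*-congˡ (others i i≢j)) (zeroʳ (coef i)))) ⟩
      ∑ (λ i → coef i * φ i)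
        ≈⟨ sum-cong-≋ (λ i → *-distribˡ-∑ᶠ s (coef i) (λ f → W f * v i f)) ⟩
      ∑ (λ i → ∑ᶠ s (λ f → coef i * (W f * v i f)))
        ≈⟨ sum-cong-≋ (λ i → ∑ᶠ-cong s (λ f → x∙yz≈y∙xz (coef i) (W f) (v i f))) ⟩
      ∑ (λ i → ∑ᶠ s (λ f → W f * (coef i * v i f)))
        ≈⟨ sym (∑ᶠ-comm-∑ s (λ f i → W f * (coef i * v i f))) ⟩
      ∑ᶠ s (λ f → ∑ (λ i → W f * (coef i * v i f)))
        ≈⟨ ∑ᶠ-cong s (λ f → sym (*-distribˡ-sum (W f) (λ i → coef i * v i f))) ⟩
      ∑ᶠ s (λ f → W f * ∑ (λ i → coef i * v i f))
        ≈⟨ ∑ᶠ-zero s (λ f → trans (*-congˡ (relation f)) (zeroʳ (W f))) ⟩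
      0#
        ∎))
    where
    φ : Fin _ → Carrier
    φ i = ∑ᶠ s (λ f → W f * v i f)

module FiniteField {c ℓ : Level} (F : Field c ℓ) {M : ℕ} (card : HasCardinality F M) where
  open Field F
  open FiniteSums commutativeSemiring
  open FieldProperties F
  open import Relation.Binary.Reasoning.Setoid setoid
  open import Algebra.Properties.Semiring.Exp semiring using (^-congˡ)

  private
    enum : Fin M → Carrier
    enum = proj₁ card

    enum-injective : ∀ i j → enum i ≈ enum j → i ≡ j
    enum-injective = proj₁ (proj₂ card)

    index : Carrier → Fin M
    index x = proj₁ (proj₂ (proj₂ card) x)

    enum-index : ∀ x → enum (index x) ≈ x
    enum-index x = proj₂ (proj₂ (proj₂ card) x)

    index-cong : ∀ {x y} → x ≈ y → index x ≡ index y
    index-cong {x} {y} x≈y = enum-injective _ _ (trans (enum-index x) (trans x≈y (sym (enum-index y))))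

    index-enum : ∀ k → index (enum k) ≡ k
    index-enum k = enum-injective _ _ (enum-index (enum k))

  _≟_ : Decidable _≈_
  x ≟ y with index x Fin.≟ index y
  ... | yes eq = yes (begin
    x              ≈⟨ sym (enum-index x) ⟩
    enum (index x) ≡⟨ ≡.cong enum eq ⟩
    enum (index y) ≈⟨ enum-index y ⟩
    y              ∎)
  ... | no  neq = no (neq ∘ index-cong)

  private
    unzero : Carrier → Carrier
    unzero y with y ≟ 0#
    ... | yes _ = 1#
    ... | no  _ = y

    unzero-≉0 : ∀ y → unzero y ≉ 0#
    unzero-≉0 y with y ≟ 0#
    ... | yes _   = 0#≉1# ∘ sym
    ... | no  y≉0 = y≉0

    unzero-≈0 : ∀ {y} → y ≈ 0# → unzero y ≈ 1#
    unzero-≈0 {y} y≈0 with y ≟ 0#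
    ... | yes _   = refl
    ... | no  y≉0 = contradiction y≈0 y≉0

    unzero-id : ∀ {y} → y ≉ 0# → unzero y ≈ y
    unzero-id {y} y≉0 with y ≟ 0#
    ... | yes y≈0 = contradiction y≈0 y≉0
    ... | no  _   = refl

    scale : Carrier → Fin M → Fin M
    scale x k = index (x * enum k)

    scale-inverse : ∀ {x w} → x * w ≈ 1# → ∀ k → scale x (scale w k) ≡ k
    scale-inverse {x} {w} xw≈1 k = ≡.trans (index-cong (begin
      x * enum (scale w k)  ≈⟨ *-congˡ (enum-index (w * enum k)) ⟩
      x * (w * enum k)      ≈⟨ sym (*-assoc x w (enum k)) ⟩
      (x * w) * enum k      ≈⟨ *-congʳ xw≈1 ⟩
      1# * enum k           ≈⟨ *-identityˡ (enum k) ⟩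
      enum k                ∎)) (index-enum k)

  -- Multiplication by x ≉ 0 permutes the elements and fixes 0. Counting 0 as 1 makes the product
  -- of all elements invertible, and comparing it with the product of their x-multiples gives x ^ M ≈ x.
  fermat : ∀ x → x ^ M ≈ x
  fermat x with x ≟ 0#
  ... | yes x≈0 = begin
    x ^ M   ≈⟨ ^-congˡ M x≈0 ⟩
    0# ^ M  ≈⟨ 0^n≈0 M {{Fin.nonZeroIndex (index 0#)}} ⟩
    0#      ≈⟨ sym x≈0 ⟩
    x       ∎
  ... | no x≉0 with inverse x x≉0
  ...   | w , xw≈1 = sym (*-cancelˡ (∏-≉0 b (unzero-≉0 ∘ enum)) (begin
    ∏ b * x              ≈⟨ *-comm (∏ b) x ⟩
    x * ∏ b              ≈⟨ *-congˡ (∏-permute b scaling) ⟩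
    x * ∏ (b ∘ scale x)  ≈⟨ ∏-scale-except x (b ∘ scale x) b (index 0#) scaled fixed ⟩
    x ^ M * ∏ b          ≈⟨ *-comm (x ^ M) (∏ b) ⟩
    ∏ b * x ^ M          ∎))
    where
    wx≈1 : w * x ≈ 1#
    wx≈1 = trans (*-comm w x) xw≈1

    scaling : Permutation M M
    scaling = permutation (scale x) (scale w) (scale-inverse xw≈1) (scale-inverse wx≈1)

    b : Fin M → Carrier
    b = unzero ∘ enum

    enum-scale : ∀ k → enum (scale x k) ≈ x * enum k
    enum-scale k = enum-index (x * enum k)

    scaled : ∀ k → k ≢ index 0# → b (scale x k) ≈ x * b k
    scaled k k≢0 = begin
      unzero (enum (scale x k))  ≈⟨ unzero-id (x≉0∧y≉0⇒xy≉0 x≉0 enumk≉0 ∘ trans (sym (enum-scale k))) ⟩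
      enum (scale x k)           ≈⟨ enum-scale k ⟩
      x * enum k                 ≈⟨ *-congˡ (sym (unzero-id enumk≉0)) ⟩
      x * unzero (enum k)        ∎
      where
      enumk≉0 : enum k ≉ 0#
      enumk≉0 enumk≈0 = k≢0 (≡.trans (≡.sym (index-enum k)) (index-cong enumk≈0))

    fixed : b (scale x (index 0#)) ≈ b (index 0#)
    fixed = trans (unzero-≈0 (trans (enum-scale (index 0#)) (trans (*-congˡ (enum-index 0#)) (zeroʳ x))))
                  (sym (unzero-≈0 (enum-index 0#)))

module TwistedTensorEmbedding {c ℓ : Level} (F : Field c ℓ) (q t : ℕ) (card : HasCardinality F (q ℕ.^ t)) where
  open Field F
  open FiniteSums commutativeSemiring
  open FieldProperties F
  open FiniteField F card
  open import Relation.Binary.Reasoning.Setoid setoid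
  open import Algebra.Properties.Semiring.Exp semiring using (^-congʳ)
  open import Algebra.Properties.CommutativeSemiring.Exp commutativeSemiring using (^-distrib-*)
  open import Algebra.Properties.Group +-group using (x∙y⁻¹≈ε⇒x≈y; x≈y⇒x∙y⁻¹≈ε)
  open import Algebra.Properties.Ring ring using (-‿distribˡ-*)

  q^ : Fin t → ℕ
  q^ i = q ℕ.^ toℕ i

  α : ∀ {r} → (Fin r → Carrier) → (Fin t → Fin r) → Carrier
  α x f = ∏ (λ i → x (f i) ^ q^ i)

  alpha≡α : ∀ {r} (x : Fin r → Carrier) f → alpha F q t r x f ≡ α x f
  alpha≡α x f = ≡.trans (prodF≡∏ t _) (∏-cong-≗ (λ i → pow≡^ (x (f i)) (q^ i)))

  frobenius-injective : ∀ i {x y} → x ^ q^ i ≈ y ^ q^ i → x ≈ y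
  frobenius-injective i = ^-injective (q^ i) (q ℕ.^ (t ℕ.∸ toℕ i)) (λ x → trans (^-congʳ x q^t-split) (fermat x))
    where
    q^t-split : q^ i ℕ.* q ℕ.^ (t ℕ.∸ toℕ i) ≡ q ℕ.^ t
    q^t-split = ≡.trans (≡.sym (ℕ.^-distribˡ-+-* q (toℕ i) (t ℕ.∸ toℕ i)))
                        (≡.cong (q ℕ.^_) (ℕ.m+[n∸m]≡n (ℕ.<⇒≤ (Fin.toℕ<n i))))

  module Separator {r} (P : Fin (suc t) → Fin r → Carrier) (P≢0 : ∀ j → NonZeroVec F (P j))
    (distinct : ∀ i j → i ≢ j → ¬ ProjEq F (P i) (P j)) (j₀ : Fin (suc t)) where

    other : Fin t → Fin (suc t)
    other = punchIn j₀

    minor : ∀ i → ∃₂ λ k l → P j₀ k * P (other i) l ≉ P j₀ l * P (other i) k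
    minor i = distinct⇒nonzero-minor _≟_ (P j₀) (P (other i)) (P≢0 (other i))
                (distinct j₀ (other i) (Fin.punchInᵢ≢i j₀ i ∘ ≡.sym))

    k l : Fin t → Fin r
    k i = proj₁ (minor i)
    l i = proj₁ (proj₂ (minor i))

    form : Fin t → Fin r → Carrier
    form i k′ = P (other i) (l i) ^ q^ i * δ (k i) k′ + - (P (other i) (k i) ^ q^ i) * δ (l i) k′

    evaluate : Fin t → (Fin r → Carrier) → Carrier
    evaluate i x = ∑ (λ k′ → form i k′ * x k′ ^ q^ i)

    evaluate-expand : ∀ i x → evaluate i x ≈
      P (other i) (l i) ^ q^ i * x (k i) ^ q^ i - P (other i) (k i) ^ q^ i * x (l i) ^ q^ i
    evaluate-expand i x = trans (∑-δ-pair _ _ (k i) (l i) (λ k′ → x k′ ^ q^ i))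
                                (+-congˡ (sym (-‿distribˡ-* _ _)))

    evaluate-other : ∀ i → evaluate i (P (other i)) ≈ 0#
    evaluate-other i = trans (evaluate-expand i (P (other i))) (x≈y⇒x∙y⁻¹≈ε (*-comm _ _))

    evaluate-j₀ : ∀ i → evaluate i (P j₀) ≉ 0#
    evaluate-j₀ i value≈0 = proj₂ (proj₂ (minor i)) (begin
      u (k i) * v (l i)  ≈⟨ *-comm _ _ ⟩
      v (l i) * u (k i)  ≈⟨ frobenius-injective i (begin
        (v (l i) * u (k i)) ^ q^ i        ≈⟨ ^-distrib-* _ _ (q^ i) ⟩
        v (l i) ^ q^ i * u (k i) ^ q^ i   ≈⟨ x∙y⁻¹≈ε⇒x≈y _ _ (trans (sym (evaluate-expand i u)) value≈0) ⟩
        v (k i) ^ q^ i * u (l i) ^ q^ i   ≈⟨ sym (^-distrib-* _ _ (q^ i)) ⟩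
        (v (k i) * u (l i)) ^ q^ i        ∎) ⟩
      v (k i) * u (l i)  ≈⟨ *-comm _ _ ⟩
      u (l i) * v (k i)  ∎)
      where
      u v : Fin r → Carrier
      u = P j₀
      v = P (other i)

    W : (Fin t → Fin r) → Carrier
    W f = ∏ (λ i → form i (f i))

    W-pairing : ∀ x → ∑ᶠ t (λ f → W f * α x f) ≈ ∏ (λ i → evaluate i x)
    W-pairing x = trans (∑ᶠ-cong t (λ f → sym (∏-distrib-* (λ i → form i (f i)) (λ i → x (f i) ^ q^ i))))
                        (∑ᶠ-∏ t (λ i k′ → form i k′ * x k′ ^ q^ i))

    W-other : ∀ j → j ≢ j₀ → ∑ᶠ t (λ f → W f * α (P j) f) ≈ 0#
    W-other j j≢j₀ = trans (W-pairing (P j)) (∏-zero _ i evaluate-j≈0)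
      where
      j₀≢j : j₀ ≢ j
      j₀≢j = j≢j₀ ∘ ≡.sym

      i : Fin t
      i = punchOut j₀≢j

      evaluate-j≈0 : evaluate i (P j) ≈ 0#
      evaluate-j≈0 = ≡.subst (λ j′ → evaluate i (P j′) ≈ 0#) (Fin.punchIn-punchOut j₀≢j) (evaluate-other i)

    W-j₀ : ∑ᶠ t (λ f → W f * α (P j₀) f) ≉ 0#
    W-j₀ = ∏-≉0 (λ i → evaluate i (P j₀)) evaluate-j₀ ∘ trans (sym (W-pairing (P j₀)))

  α-independent : ∀ {r} (P : Fin (suc t) → Fin r → Carrier) → (∀ j → NonZeroVec F (P j)) →
    (∀ i j → i ≢ j → ¬ ProjEq F (P i) (P j)) →
    (coef : Fin (suc t) → Carrier) → (∀ f → ∑ (λ j → coef j * α (P j) f) ≈ 0#) → ∀ j → coef j ≈ 0#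
  α-independent P P≢0 distinct coef relation j₀ =
    separated⇒coef≈0 (λ j → α (P j)) W coef j₀ relation W-other W-j₀
    where open Separator P P≢0 distinct j₀

mainTheorem2 : ∀ {c ℓ} (q r t : ℕ) → IsPrimePower q → 2 ≤ r → 2 ≤ t →
    (F : Field c ℓ) → HasCardinality F (q ℕ.^ t) →
    (P : Fin (suc t) → Fin r → Field.Carrier F) →
    (∀ i → NonZeroVec F (P i)) →
    (∀ i j → i ≢ j → ¬ ProjEq F (P i) (P j)) →
    LinIndep F (suc t) (λ i → alpha F q t r (P i))
mainTheorem2 q r t _ _ _ F card P P≢0 distinct coef relation =
  α-independent P P≢0 distinct coef (λ f → ≡.subst (_≈ 0#) (in-library-notation f) (relation f))
  where
  open Field F
  open FiniteSums commutativeSemiring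
  open FieldProperties F
  open TwistedTensorEmbedding F q t card

  in-library-notation : ∀ f →
    sumF F (suc t) (λ j → coef j * alpha F q t r (P j) f) ≡ ∑ (λ j → coef j * α (P j) f)
  in-library-notation f = ≡.trans (sumF≡∑ (suc t) (λ j → coef j * alpha F q t r (P j) f))
                                  (sum-cong-≗ (λ j → ≡.cong (coef j *_) (alpha≡α (P j) f)))
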